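{- Let $X\in\sigma\mathcal F$ and $F\in\mathsf{age}(X)$. Then $\mathsf{rk}_X(F)=\infty$ if and only if Player II has a winning strategy in the rank game on $X$ starting from $F$.
   Context: Let $\mathcal L$ be a countable relational language without constant symbols and $\mathcal F$ a class of finite $\mathcal L$-structures closed under isomorphism and under (induced) substructures. $\sigma\mathcal F$ denotes the class of all countable structures isomorphic to unions of chains of structures in $\mathcal F$; $\mathsf{age}(X)$ is the set of finite substructures of $X$. If $A\le B$ and $|B\setminus A|=1$, $B$ is a prime extension of $A$. If $A\le B$ and $A\le X$, a realization of $B$ in $X$ is some $C\le X$ with $A\le C$ and an isomorphism $B\to C$ that is the identity on $A$. Rank: $\mathsf{rk}_X(F)\ge 0$ always; $\mathsf{rk}_X(F)\ge\alpha+1$ iff every prime extension $B\in\mathcal F$ of $F$ has a realization $C$ in $X$ with $\mathsf{rk}_X(C)\ge\alpha$; for limit $\alpha$, $\mathsf{rk}_X(F)\ge\alpha$ iff $\mathsf{rk}_X(F)\ge\beta$ for all $\beta<\alpha$; $\mathsf{rk}_X(F)=\sup\{\alpha:\mathsf{rk}_X(F)\ge\alpha\}$, and $\mathsf{rk}_X(F)=\infty$ if $\mathsf{rk}_X(F)\ge\alpha$ for every ordinal $\alpha$. The rank game on $X$ starting from $F$: players I and II play $\omega$ rounds; at round $n$, with current position $F_n\in\mathsf{age}(X)$ ($F_0=F$), I chooses a prime extension $B\in\mathcal F$ of $F_n$, and II responds with a realization $C$ of $B$ in $X$, setting $F_{n+1}=C$. II loses at round $n$ if no realization exists; II wins if the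 game lasts all $\omega$ rounds. -}

module Defs where

open import Level using (Level; 0ℓ) renaming (suc to lsuc)
open import Data.Nat using (ℕ; zero; suc)
open import Data.Fin using (Fin)
open import Data.Bool using (Bool)
open import Data.Unit using (⊤)
open import Data.Maybe using (Maybe; just; nothing)
open import Data.Product using (Σ; Σ-syntax; ∃; ∃-syntax; _×_; _,_)
open import Data.Vec.Functional using (Vector; _∷_)
open import Function using (_∘_)
open import Function.Bundles using (_↣_)
open import Function.Definitions using (Injective; Bijective)
open import Relation.Binary.PropositionalEquality using (_≡_)

record Lang : Set₁ where
  field
    Sym       : Set
    arity     : Sym → ℕ
    countable : Sym ↣ ℕ
open Lang public

record Str (L : Lang) (A : Set) : Set where
  constructor mkStr
  field
    rel : (R : Sym L) → (Fin (arity L R) → A) → Bool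
open Str public

-- Pull back (induced) structure along a map f : B → A.  When f is
-- injective this is the substructure on the image of f, transported to B.
pull : ∀ {L A B} → Str L A → (B → A) → Str L B
pull S f = mkStr (λ R a → rel S R (f ∘ a))

_≈S_ : ∀ {L A} → Str L A → Str L A → Set
_≈S_ {L} S T = ∀ (R : Sym L) a → rel S R a ≡ rel T R a

Class : Lang → Set₁
Class L = (n : ℕ) → Str L (Fin n) → Set

IsoClosed : ∀ {L} → Class L → Set
IsoClosed {L} 𝓕 = ∀ {m n} (A : Str L (Fin n)) (B : Str L (Fin m))
  (π : Fin m → Fin n) → Bijective _≡_ _≡_ π → pull A π ≈S B →
  𝓕 n A → 𝓕 m B

SubClosed : ∀ {L} → Class L → Set
SubClosed {L} 𝓕 = ∀ {m n} (A : Str L (Fin n)) (f : Fin m → Fin n) →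
  Injective _≡_ _≡_ f → 𝓕 n A → 𝓕 m (pull A f)

record Structure (L : Lang) : Set₁ where
  field
    Carrier : Set
    str     : Str L Carrier
open Structure public

-- Finite substructures of X, i.e. elements of age(X): a finite subset of
-- the carrier, given by an injective enumeration, with the induced structure.
record FinSub {L} (X : Structure L) : Set where
  constructor fsub
  field
    size : ℕ
    enum : Fin size → Carrier X
    inj  : Injective _≡_ _≡_ enum
open FinSub public

induced : ∀ {L} {X : Structure L} → (F : FinSub X) → Str L (Fin (size F))
induced {X = X} F = pull (str X) (enum F)

_⊆_ : ∀ {L} {X : Structure L} → FinSub X → FinSub X → Set
F ⊆ G = ∀ i → ∃[ j ] enum G j ≡ enum F i

-- X ∈ σ𝓕 : X is the union of a chain (indexed by ℕ) of finite
-- substructures each of which belongs to 𝓕 (up to isomorphism; 𝓕 is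
-- iso-closed).  Covering by countably many finite sets makes X countable.
InSigma : ∀ {L} → Class L → Structure L → Set
InSigma 𝓕 X = Σ[ c ∈ (ℕ → FinSub X) ]
    ((∀ k → c k ⊆ c (suc k))
  × (∀ k → 𝓕 (size (c k)) (induced (c k)))
  × (∀ (x : Carrier X) → ∃[ k ] ∃[ i ] enum (c k) i ≡ x))

-- A prime extension B of F (with B ∈ 𝓕) is represented, up to isomorphism
-- over F, as a structure on Fin (suc n) whose new element is 'zero' and
-- whose restriction along 'suc' is exactly F.

record PrimeExt {L} (𝓕 : Class L) {X : Structure L} (F : FinSub X) : Set where
  field
    ext    : Str L (Fin (suc (size F)))
    inCls  : 𝓕 (suc (size F)) ext
    extend : pull ext Fin.suc ≈S induced F
open PrimeExt public

-- A realization of B in X: an embedding of B into X that is the identity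
-- on F, i.e. a point x such that (x ∷ enum F) is injective and induces B.
record Realization {L} {𝓕 : Class L} {X : Structure L} (F : FinSub X)
                   (B : PrimeExt 𝓕 F) : Set where
  field
    point : Carrier X
    inj   : Injective _≡_ _≡_ (point ∷ enum F)
    iso   : pull (str X) (point ∷ enum F) ≈S ext B
open Realization public

realized : ∀ {L} {𝓕 : Class L} {X : Structure L} {F : FinSub X} {B : PrimeExt 𝓕 F}
           → Realization F B → FinSub X
realized {F = F} r = fsub (suc (size F)) (point r ∷ enum F) (inj r)

-- Ordinals (Brouwer trees with suprema of arbitrary Set-indexed families)

data Ord : Set₁ where
  zero : Ord
  suc  : Ord → Ord
  sup  : {I : Set} → (I → Ord) → Ord

RkGe : ∀ {L} (𝓕 : Class L) (X : Structure L) → Ord → FinSub X → Set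
RkGe 𝓕 X zero    F = ⊤
RkGe 𝓕 X (suc α) F = (B : PrimeExt 𝓕 F) →
  Σ[ r ∈ Realization F B ] RkGe 𝓕 X α (realized r)
RkGe 𝓕 X (sup f) F = ∀ i → RkGe 𝓕 X (f i) F

RkInfty : ∀ {L} (𝓕 : Class L) (X : Structure L) → FinSub X → Set₁
RkInfty 𝓕 X F = (α : Ord) → RkGe 𝓕 X α F

-- A history is a finite sequence of rounds: I's move B (a prime extension
-- in 𝓕 of the current position) and II's answer r (a realization of B),
-- the new position being the realized substructure.

data Hist {L} (𝓕 : Class L) {X : Structure L} (F : FinSub X) : FinSub X → Set where
  here : Hist 𝓕 F F
  step : ∀ {G} → Hist 𝓕 F G → (B : PrimeExt 𝓕 G) → (r : Realization G B) →
         Hist 𝓕 F (realized r)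

-- A strategy for II: to each history and move B of I, an answer
-- (nothing = II has no answer / gives up).
Strategy : ∀ {L} (𝓕 : Class L) (X : Structure L) → FinSub X → Set
Strategy 𝓕 X F = ∀ {G} → Hist 𝓕 F G → (B : PrimeExt 𝓕 G) → Maybe (Realization G B)

Consistent : ∀ {L} {𝓕 : Class L} {X : Structure L} {F : FinSub X} →
  Strategy 𝓕 X F → ∀ {G} → Hist 𝓕 F G → Set
Consistent σ here         = ⊤
Consistent σ (step h B r) = Consistent σ h × σ h B ≡ just r

-- σ is winning: along every play consistent with σ, σ always answers,
-- so the game lasts all ω rounds.
Winning : ∀ {L} {𝓕 : Class L} {X : Structure L} {F : FinSub X} →
  Strategy 𝓕 X F → Set
Winning {𝓕 = 𝓕} {F = F} σ = ∀ {G} (h : Hist 𝓕 F G) → Consistent σ h →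
  (B : PrimeExt 𝓕 G) → Σ[ r ∈ Realization G B ] σ h B ≡ just r

IIWins : ∀ {L} (𝓕 : Class L) (X : Structure L) → FinSub X → Set
IIWins 𝓕 X F = Σ[ σ ∈ Strategy 𝓕 X F ] Winning σ

-- A winning strategy for II keeps answering along every play that follows
-- it, so it yields realizations of rank ≥ α at every position, by induction
-- on α.  Conversely, rank ∞ is inherited by some realization of every prime
-- extension: otherwise each realization r has some α_r it fails, and then F
-- fails suc (sup α_r).  II wins by always moving to such a realization,
-- which exists classically.
module Submission where

open import Defs
open import Level using (0ℓ; lift; lower)
open import Axiom.ExcludedMiddle using (ExcludedMiddle)
open import Axiom.DoubleNegationElimination using (em⇒dne)
open import Function using (_∘_)
open import Function.Bundles using (_⇔_; mk⇔)
open import Data.Product using (Σ; Σ-syntax; ∃-syntax; _,_; proj₁; proj₂)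
open import Data.Maybe as Maybe using (Maybe; just)
open import Data.Unit using (tt)
open import Relation.Nullary using (Dec; yes; no; ¬_)
open import Relation.Nullary.Decidable using (dec⇒maybe)
open import Relation.Nullary.Negation using (Stable; ¬¬-map; contradiction)
open import Relation.Binary.PropositionalEquality using (_≡_; refl)

choose : ∀ {a} {A : Set} {P : A → Set a} → Dec (Σ A P) → Maybe A
choose = Maybe.map proj₁ ∘ dec⇒maybe

choose-sound : ∀ {a} {A : Set} {P : A → Set a} (d : Dec (Σ A P)) {x : A} →
               choose d ≡ just x → P x
choose-sound (yes (x , px)) refl = px

choose-complete : ∀ {a} {A : Set} {P : A → Set a} (d : Dec (Σ A P)) →
                  Σ A P → Σ[ x ∈ A ] choose d ≡ just x
choose-complete (yes (x , _)) _  = x , refl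
choose-complete (no ¬p)       p  = contradiction p ¬p

module _ {L : Lang} {𝓕 : Class L} {X : Structure L} {F : FinSub X} where

  winning⇒rkGe : (σ : Strategy 𝓕 X F) → Winning σ →
                 ∀ α {G} (h : Hist 𝓕 F G) → Consistent σ h → RkGe 𝓕 X α G
  winning⇒rkGe σ win zero    h c   = tt
  winning⇒rkGe σ win (suc α) h c B =
    let (r , σ-answers) = win h c B
    in  r , winning⇒rkGe σ win α (step h B r) (c , σ-answers)
  winning⇒rkGe σ win (sup f) h c i = winning⇒rkGe σ win (f i) h c

  iiWins⇒rkInfty : IIWins 𝓕 X F → RkInfty 𝓕 X F
  iiWins⇒rkInfty (σ , win) α = winning⇒rkGe σ win α here tt

module Classical (lem : ExcludedMiddle (Level.suc 0ℓ))
                 {L : Lang} {𝓕 : Class L} {X : Structure L} where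

  rkGe-stable : ∀ α G → Stable (RkGe 𝓕 X α G)
  rkGe-stable α G ¬¬ge = lower (em⇒dne lem (¬¬-map lift ¬¬ge))

  ¬rkInfty⇒∃¬rkGe : ∀ {G} → ¬ RkInfty 𝓕 X G → ∃[ α ] ¬ RkGe 𝓕 X α G
  ¬rkInfty⇒∃¬rkGe {G} ¬∞ =
    em⇒dne lem λ ¬∃ → ¬∞ λ α → rkGe-stable α G λ ¬ge → ¬∃ (α , ¬ge)

  rkInfty-extends : ∀ {G} → RkInfty 𝓕 X G → (B : PrimeExt 𝓕 G) →
                    Σ[ r ∈ Realization G B ] RkInfty 𝓕 X (realized r)
  rkInfty-extends {G} ∞ B = em⇒dne lem λ ¬good →
    let failed : Realization G B → Ord
        failed r = proj₁ (¬rkInfty⇒∃¬rkGe (¬good ∘ (r ,_)))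
        (r , ge) = ∞ (suc (sup failed)) B
    in  proj₂ (¬rkInfty⇒∃¬rkGe (¬good ∘ (r ,_))) (ge r)

  module _ {F : FinSub X} where

    rankStrategy : Strategy 𝓕 X F
    rankStrategy {G} _ B = choose (lem {Σ[ r ∈ Realization G B ] RkInfty 𝓕 X (realized r)})

    rankStrategy-keeps-rkInfty : RkInfty 𝓕 X F → ∀ {G} (h : Hist 𝓕 F G) →
                                 Consistent rankStrategy h → RkInfty 𝓕 X G
    rankStrategy-keeps-rkInfty ∞ here         _            = ∞
    rankStrategy-keeps-rkInfty ∞ (step h B r) (_ , answer) = choose-sound lem answer

    rankStrategy-winning : RkInfty 𝓕 X F → Winning rankStrategy
    rankStrategy-winning ∞ h c B =
      choose-complete lem (rkInfty-extends (rankStrategy-keeps-rkInfty ∞ h c) B)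

    rkInfty⇒iiWins : RkInfty 𝓕 X F → IIWins 𝓕 X F
    rkInfty⇒iiWins ∞ = rankStrategy , rankStrategy-winning ∞

proposition2p6 : ExcludedMiddle (Level.suc 0ℓ) →
    (L : Lang) (𝓕 : Class L) → IsoClosed 𝓕 → SubClosed 𝓕 →
    (X : Structure L) → InSigma 𝓕 X → (F : FinSub X) →
    RkInfty 𝓕 X F ⇔ IIWins 𝓕 X F
proposition2p6 lem L 𝓕 _ _ X _ F = mk⇔ rkInfty⇒iiWins iiWins⇒rkInfty
  where open Classical lem
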